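{- Let $G$ be a DAG whose underlying graph is a cycle and let $s$ be a source (respectively, $t$ a sink) of $G$. Then $G$ admits a $2$-page upward book embedding $\langle\pi,\sigma\rangle$ in which $s$ is the first vertex of $\pi$ (respectively, $t$ is the last vertex of $\pi$).
   Context: A $k$-page upward book embedding of a DAG $G=(V,E)$ is a pair $\langle \pi,\sigma\rangle$ where $\pi\colon V\to\{1,\dots,|V|\}$ is a bijection with $\pi(u)<\pi(v)$ for every directed edge $uv$, and $\sigma\colon E\to\{1,\dots,k\}$ is such that no two same-page edges cross; edges $uv,wx$ with $\pi(u)<\pi(v)$, $\pi(w)<\pi(x)$, $\pi(u)<\pi(w)$ cross if $\pi(u)<\pi(w)<\pi(v)<\pi(x)$. A source is a vertex that is the tail of all its incident edges; a sink is the head of all its incident edges. -}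

module Defs where

open import Data.Nat using (ℕ; zero; suc; _<_; NonZero)
open import Data.Nat.DivMod using (_mod_)
open import Data.Fin using (Fin; toℕ)
open import Data.Bool using (Bool; true; false)
open import Data.Product using (Σ; ∃; _×_)
open import Data.Sum using (_⊎_)
open import Relation.Binary.PropositionalEquality using (_≡_)
open import Relation.Binary.Construct.Closure.Transitive using (TransClosure)
open import Relation.Nullary using (¬_)
open import Function.Definitions using (Injective)

-- An oriented cycle on n vertices (n ≥ 3 assumed in the statement).
-- Vertices are Fin n; the underlying undirected graph has the n edges
-- e_i = {i , i+1 mod n}, indexed by i : Fin n.  An orientation
-- o : Fin n → Bool says o i = true  : edge e_i is directed i → i+1,
--                      o i = false : edge e_i is directed i+1 → i.
-- Every directed graph whose underlying graph is a cycle is isomorphic to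
-- one of these (up to relabelling of vertices).

module _ (n : ℕ) .{{_ : NonZero n}} where

  nextV : Fin n → Fin n
  nextV i = suc (toℕ i) mod n

  tail : (Fin n → Bool) → Fin n → Fin n
  tail o i with o i
  ... | true  = i
  ... | false = nextV i

  head : (Fin n → Bool) → Fin n → Fin n
  head o i with o i
  ... | true  = nextV i
  ... | false = i

  Arc : (Fin n → Bool) → Fin n → Fin n → Set
  Arc o u v = ∃ λ e → tail o e ≡ u × head o e ≡ v

  IsDAG : (Fin n → Bool) → Set
  IsDAG o = ∀ v → ¬ TransClosure (Arc o) v v

  Incident : (Fin n → Bool) → Fin n → Fin n → Set
  Incident o v e = tail o e ≡ v ⊎ head o e ≡ v

  IsSource : (Fin n → Bool) → Fin n → Set
  IsSource o s = ∀ e → Incident o s e → tail o e ≡ s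

  IsSink : (Fin n → Bool) → Fin n → Set
  IsSink o t = ∀ e → Incident o t e → head o e ≡ t

  -- position of a vertex in the order π (0-based: 0 is the first vertex, n-1 the last)
  pos : (Fin n → Fin n) → Fin n → ℕ
  pos π v = toℕ (π v)

  Cross : (Fin n → Bool) → (Fin n → Fin n) → Fin n → Fin n → Set
  Cross o π e f =
    pos π (tail o e) < pos π (tail o f) ×
    pos π (tail o f) < pos π (head o e) ×
    pos π (head o e) < pos π (head o f)

  -- ⟨π , σ⟩ is a k-page upward book embedding of the oriented cycle o.
  -- π : Fin n → Fin n injective (hence a bijection onto positions 1..n,
  -- written 0..n-1 here); σ assigns each edge one of k pages.
  IsUpwardBookEmbedding : (k : ℕ) → (Fin n → Bool) → (Fin n → Fin n) → (Fin n → Fin k) → Set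
  IsUpwardBookEmbedding k o π σ =
    Injective _≡_ _≡_ π ×
    (∀ e → pos π (tail o e) < pos π (head o e)) ×
    (∀ e f → σ e ≡ σ f → ¬ Cross o π e f)

-- Cut the cycle at the edge x joining the source (or sink) x to nextV x.  What remains is a
-- path through the vertices at distance d = 1, …, N from x (x itself at distance N).  Put
-- the vertex at distance d at key C ± d, to the right of the centre C iff the path edge
-- reaching it from distance d - 1 points towards it.  Every path edge then joins two
-- neighbouring keys or straddles C, and the straddling edges are nested, so the path fits on
-- one page and the cut edge takes the second.  The last path edge points away from a source
-- (towards a sink), which puts x at key 0 (at the largest key 2N): first (last) in the order.

module Submission where

open import Defs
open import Data.Nat using (ℕ; zero; suc; pred; _+_; _∸_; _≤_; _<_; z≤n; s≤s; s≤s⁻¹; NonZero; _%_; _<?_)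
open import Data.Nat.Properties hiding (_≟_)
open import Data.Nat.DivMod using (n%n≡0; %-distribˡ-+; m%n%n≡m%n; [m+n]%n≡m%n; m<n⇒m%n≡m; m%n<n)
open import Data.Fin using (Fin; zero; suc; toℕ; fromℕ<; _≟_)
open import Data.Fin.Properties using (toℕ-fromℕ<; toℕ-injective; toℕ<n; injective⇒≤)
open import Data.Vec using (Vec; []; _∷_; allFin; count)
open import Data.Vec.Properties using (count≤n)
open import Data.Vec.Relation.Unary.Any using (here; there)
open import Data.Vec.Membership.Propositional using (_∈_)
open import Data.Vec.Membership.Propositional.Properties using (∈-allFin⁺)
open import Data.Bool using (Bool; true; false; if_then_else_)
open import Data.Product using (Σ; _×_; _,_)
open import Data.Sum using (inj₁; inj₂)
open import Function using (_∘_)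
open import Function.Definitions using (Injective)
open import Relation.Binary using (tri<; tri≈; tri>)
open import Relation.Binary.PropositionalEquality
  using (_≡_; _≢_; refl; sym; trans; cong; subst; subst₂; module ≡-Reasoning)
open import Relation.Nullary using (¬_; yes; no; contradiction)
open import Relation.Unary using (Pred; Decidable; _⊆_)

module _ {a p q} {A : Set a} {P : Pred A p} {Q : Pred A q}
         (P? : Decidable P) (Q? : Decidable Q) (P⊆Q : P ⊆ Q) where

  count-mono : ∀ {n} (xs : Vec A n) → count P? xs ≤ count Q? xs
  count-mono []       = z≤n
  count-mono (x ∷ xs) with P? x | Q? x
  ... | yes _  | yes _  = s≤s (count-mono xs)
  ... | yes px | no ¬qx = contradiction (P⊆Q px) ¬qx
  ... | no _   | yes _  = m≤n⇒m≤1+n (count-mono xs)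
  ... | no _   | no _   = count-mono xs

  count-strict : ∀ {n} {xs : Vec A n} {x} → x ∈ xs → ¬ P x → Q x →
                 count P? xs < count Q? xs
  count-strict {xs = y ∷ ys} (here refl) ¬py qy with P? y | Q? y
  ... | yes py | _      = contradiction py ¬py
  ... | no _   | yes _  = s≤s (count-mono ys)
  ... | no _   | no ¬qy = contradiction qy ¬qy
  count-strict {xs = y ∷ ys} (there x∈ys) ¬px qx with P? y | Q? y
  ... | yes _  | yes _  = s≤s (count-strict x∈ys ¬px qx)
  ... | yes py | no ¬qy = contradiction (P⊆Q py) ¬qy
  ... | no _   | yes _  = m≤n⇒m≤1+n (count-strict x∈ys ¬px qx)
  ... | no _   | no _   = count-strict x∈ys ¬px qx

module _ {a p} {A : Set a} {P : Pred A p} (P? : Decidable P) where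

  count<n : ∀ {n} {xs : Vec A n} {x} → x ∈ xs → ¬ P x → count P? xs < n
  count<n {xs = y ∷ ys} (here refl) ¬py with P? y
  ... | yes py = contradiction py ¬py
  ... | no _   = s≤s (count≤n P? ys)
  count<n {xs = y ∷ ys} (there x∈ys) ¬px with P? y
  ... | yes _ = s≤s (count<n x∈ys ¬px)
  ... | no _  = m≤n⇒m≤1+n (count<n x∈ys ¬px)

  count-none : (∀ x → ¬ P x) → ∀ {n} (xs : Vec A n) → count P? xs ≡ 0
  count-none ¬P []       = refl
  count-none ¬P (x ∷ xs) with P? x
  ... | yes px = contradiction px (¬P x)
  ... | no _   = count-none ¬P xs

module Ranking {N : ℕ} (K : Fin N → ℕ) where

  countBelow : ℕ → ℕ
  countBelow k = count (λ u → K u <? k) (allFin N)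

  rank : Fin N → ℕ
  rank v = countBelow (K v)

  rank<N : ∀ v → rank v < N
  rank<N v = count<n (λ u → K u <? K v) (∈-allFin⁺ v) (<-irrefl refl)

  rank-mono-≤ : ∀ {u v} → K u ≤ K v → rank u ≤ rank v
  rank-mono-≤ Ku≤Kv = count-mono _ _ (λ lt → <-≤-trans lt Ku≤Kv) (allFin N)

  rank-mono-< : ∀ {u v} → K u < K v → rank u < rank v
  rank-mono-< {u} Ku<Kv =
    count-strict _ _ (λ lt → <-trans lt Ku<Kv) (∈-allFin⁺ u) (<-irrefl refl) Ku<Kv

  rank-cancel-< : ∀ {u v} → rank u < rank v → K u < K v
  rank-cancel-< {u} {v} ru<rv with <-cmp (K u) (K v)
  ... | tri< Ku<Kv _ _ = Ku<Kv
  ... | tri≈ _ Ku≡Kv _ = contradiction (cong countBelow Ku≡Kv) (<⇒≢ ru<rv)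
  ... | tri> _ _ Ku>Kv = contradiction (rank-mono-< Ku>Kv) (<-asym ru<rv)

  rank-injective : Injective _≡_ _≡_ K → Injective _≡_ _≡_ rank
  rank-injective K-inj {u} {v} ru≡rv with <-cmp (K u) (K v)
  ... | tri< Ku<Kv _ _ = contradiction ru≡rv (<⇒≢ (rank-mono-< Ku<Kv))
  ... | tri≈ _ Ku≡Kv _ = K-inj Ku≡Kv
  ... | tri> _ _ Ku>Kv = contradiction (sym ru≡rv) (<⇒≢ (rank-mono-< Ku>Kv))

  rankFin : Fin N → Fin N
  rankFin v = fromℕ< (rank<N v)

  toℕ-rankFin : ∀ v → toℕ (rankFin v) ≡ rank v
  toℕ-rankFin v = toℕ-fromℕ< (rank<N v)

  rankFin-injective : Injective _≡_ _≡_ K → Injective _≡_ _≡_ rankFin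
  rankFin-injective K-inj {u} {v} eq =
    rank-injective K-inj (trans (sym (toℕ-rankFin u)) (trans (cong toℕ eq) (toℕ-rankFin v)))

  rank-minimum : ∀ {v} → (∀ u → K v ≤ K u) → rank v ≡ 0
  rank-minimum min = count-none _ (λ u → ≤⇒≯ (min u)) (allFin N)

  rank-maximum : Injective _≡_ _≡_ K → ∀ {v} → (∀ u → K u ≤ K v) → suc (rank v) ≡ N
  rank-maximum K-inj {v} max = ≤-antisym (rank<N v) (injective⇒≤ {f = below} below-injective)
    where
    below : Fin N → Fin (suc (rank v))
    below u = fromℕ< (s≤s (rank-mono-≤ (max u)))

    below-injective : Injective _≡_ _≡_ below
    below-injective eq =
      rank-injective K-inj (trans (sym (toℕ-fromℕ< _)) (trans (cong toℕ eq) (toℕ-fromℕ< _)))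

open Ranking using (rankFin; toℕ-rankFin; rankFin-injective; rank-minimum; rank-maximum)

Crossing : ℕ → ℕ → ℕ → ℕ → Set
Crossing t h t′ h′ = t < t′ × t′ < h × h < h′

module _ {N k : ℕ} .{{_ : NonZero N}} {o : Fin N → Bool} {σ : Fin N → Fin k} where

  embedding-by-rank : (K : Fin N → ℕ) → Injective _≡_ _≡_ K →
    (∀ e → K (tail N o e) < K (head N o e)) →
    (∀ e f → σ e ≡ σ f →
      ¬ Crossing (K (tail N o e)) (K (head N o e)) (K (tail N o f)) (K (head N o f))) →
    IsUpwardBookEmbedding N k o (rankFin K) σ
  embedding-by-rank K K-inj upward noncrossing =
      rankFin-injective K K-inj
    , (λ e → mono (upward e))
    , λ e f σe≡σf (p , q , r) → noncrossing e f σe≡σf (cancel p , cancel q , cancel r)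
    where
    open Ranking K using (rank-mono-<; rank-cancel-<)

    mono : ∀ {u v} → K u < K v → pos N (rankFin K) u < pos N (rankFin K) v
    mono {u} {v} = subst₂ _<_ (sym (toℕ-rankFin K u)) (sym (toℕ-rankFin K v)) ∘ rank-mono-<

    cancel : ∀ {u v} → pos N (rankFin K) u < pos N (rankFin K) v → K u < K v
    cancel {u} {v} = rank-cancel-< ∘ subst₂ _<_ (toℕ-rankFin K u) (toℕ-rankFin K v)

m∸n≡1+[m∸1+n] : ∀ {m n} → suc n ≤ m → m ∸ n ≡ suc (m ∸ suc n)
m∸n≡1+[m∸1+n] {suc m} {zero}  _         = refl
m∸n≡1+[m∸1+n] {suc m} {suc n} (s≤s n<m) = m∸n≡1+[m∸1+n] n<m

-- A path with a vertex at each distance d ≥ 1, whose edge d joins distances d and d + 1 and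
-- points outward (from d to d + 1) iff outward d.
module Spiral (C : ℕ) (outward : ℕ → Bool) where

  place : Bool → ℕ → ℕ
  place true  d = C + d
  place false d = C ∸ d

  key : ℕ → ℕ
  key d = place (outward (pred d)) d

  tailDist headDist : ℕ → ℕ
  tailDist d = if outward d then d else suc d
  headDist d = if outward d then suc d else d

  left<right : ∀ a c → C ∸ a < C + suc c
  left<right a c = ≤-<-trans (m∸n≤m C a) (m<m+n C (s≤s z≤n))

  key≤ : ∀ d → key d ≤ C + d
  key≤ d with outward (pred d)
  ... | true  = ≤-refl
  ... | false = ≤-trans (m∸n≤m C d) (m≤m+n C d)

  place-injective : ∀ b b′ {d d′} → suc d ≤ C → suc d′ ≤ C →
                    place b (suc d) ≡ place b′ (suc d′) → d ≡ d′
  place-injective true  true             _  _   eq = suc-injective (+-cancelˡ-≡ C _ _ eq)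
  place-injective false false            d≤ d′≤ eq = suc-injective (∸-cancelˡ-≡ d≤ d′≤ eq)
  place-injective true  false {d} {d′} _  _   eq = contradiction (sym eq) (<⇒≢ (left<right (suc d′) d))
  place-injective false true  {d} {d′} _  _   eq = contradiction eq (<⇒≢ (left<right (suc d) d′))

  key-injective : ∀ {d d′} → suc d ≤ C → suc d′ ≤ C → key (suc d) ≡ key (suc d′) → d ≡ d′
  key-injective {d} {d′} = place-injective (outward d) (outward d′)

  data Shape (i t h : ℕ) : Set where
    adjacent   : h ≡ suc t → Shape i t h
    straddling : ∀ a c → t ≡ C ∸ a → h ≡ C + c →
                 a ≤ suc i → i ≤ a → c ≤ suc i → i ≤ c → Shape i t h

  edge-shape : ∀ d → suc (suc d) ≤ C →
               Shape (suc d) (key (tailDist (suc d))) (key (headDist (suc d)))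
  -- unfolding tailDist exposes outward (suc d) once more, inside key
  edge-shape d bound with outward (suc d) in out
  edge-shape d bound | true  rewrite out with outward d
  ... | true  = adjacent (+-suc C (suc d))
  ... | false = straddling (suc d) (suc (suc d)) refl refl (n≤1+n _) ≤-refl ≤-refl (n≤1+n _)
  edge-shape d bound | false rewrite out with outward d
  ... | true  = straddling (suc (suc d)) (suc d) refl refl ≤-refl (n≤1+n _) (n≤1+n _) ≤-refl
  ... | false = adjacent (m∸n≡1+[m∸1+n] bound)

  shape-upward : ∀ {d t h} → Shape (suc d) t h → t < h
  shape-upward (adjacent refl)                          = ≤-refl
  shape-upward (straddling a (suc c) refl refl _ _ _ _) = left<right a c

  shape-noncrossing : ∀ {i t h i′ t′ h′} → Shape i t h → Shape i′ t′ h′ →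
                      (i ≡ i′ → t ≡ t′) → ¬ Crossing t h t′ h′
  shape-noncrossing (adjacent refl) _ _ (t<t′ , t′<h , _) = <⇒≱ t<t′ (s≤s⁻¹ t′<h)
  shape-noncrossing (straddling _ _ _ _ _ _ _ _) (adjacent refl) _ (_ , t′<h , h<h′) =
    <⇒≱ t′<h (s≤s⁻¹ h<h′)
  shape-noncrossing {i} {i′ = i′} (straddling a c refl refl a≤ _ _ ≤c) (straddling a′ c′ refl refl _ ≤a′ c′≤ _)
                    same-tail (t<t′ , _ , h<h′) with <-cmp i i′
  ... | tri< i<i′ _ _ = <⇒≱ t<t′ (∸-monoʳ-≤ C (≤-trans a≤ (≤-trans i<i′ ≤a′)))
  ... | tri≈ _ i≡i′ _ = <-irrefl (same-tail i≡i′) t<t′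
  ... | tri> _ _ i>i′ = <⇒≱ h<h′ (+-monoʳ-≤ C (≤-trans c′≤ (≤-trans i>i′ ≤c)))

  spiral-upward : ∀ d → suc (suc d) ≤ C → key (tailDist (suc d)) < key (headDist (suc d))
  spiral-upward d bound = shape-upward (edge-shape d bound)

  spiral-noncrossing : ∀ d d′ → suc (suc d) ≤ C → suc (suc d′) ≤ C →
    ¬ Crossing (key (tailDist (suc d))) (key (headDist (suc d)))
               (key (tailDist (suc d′))) (key (headDist (suc d′)))
  spiral-noncrossing d d′ bound bound′ =
    shape-noncrossing (edge-shape d bound) (edge-shape d′ bound′) λ { refl → refl }

[m+n%o]%o≡[m+n]%o : ∀ m n o .{{_ : NonZero o}} → (m + n % o) % o ≡ (m + n) % o
[m+n%o]%o≡[m+n]%o m n o = begin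
  (m + n % o) % o           ≡⟨ %-distribˡ-+ m (n % o) o ⟩
  (m % o + n % o % o) % o   ≡⟨ cong (λ k → (m % o + k) % o) (m%n%n≡m%n n o) ⟩
  (m % o + n % o) % o       ≡⟨ %-distribˡ-+ m n o ⟨
  (m + n) % o               ∎
  where open ≡-Reasoning

module _ {N : ℕ} .{{_ : NonZero N}} where

  toℕ-nextV : ∀ v → toℕ (nextV N v) ≡ suc (toℕ v) % N
  toℕ-nextV v = toℕ-fromℕ< _

  nextV-irreflexive : 2 ≤ N → ∀ v → nextV N v ≢ v
  nextV-irreflexive 2≤N v eq with m≤n⇒m<n∨m≡n (toℕ<n v)
  ... | inj₁ 1+v<N = <-irrefl (sym (begin
          suc (toℕ v)           ≡⟨ m<n⇒m%n≡m 1+v<N ⟨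
          suc (toℕ v) % N       ≡⟨ toℕ-nextV v ⟨
          toℕ (nextV N v)       ≡⟨ cong toℕ eq ⟩
          toℕ v                 ∎)) ≤-refl
    where open ≡-Reasoning
  ... | inj₂ 1+v≡N = <⇒≱ 2≤N (≤-reflexive (begin
          N                     ≡⟨ 1+v≡N ⟨
          suc (toℕ v)           ≡⟨ cong (suc ∘ toℕ) eq ⟨
          suc (toℕ (nextV N v)) ≡⟨ cong suc (toℕ-nextV v) ⟩
          suc (suc (toℕ v) % N) ≡⟨ cong (λ k → suc (k % N)) 1+v≡N ⟩
          suc (N % N)           ≡⟨ cong suc (n%n≡0 N) ⟩
          1                     ∎))
    where open ≡-Reasoning

module _ {N : ℕ} .{{_ : NonZero N}} {o : Fin N → Bool} where

  tail≢head : 2 ≤ N → ∀ e → tail N o e ≢ head N o e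
  tail≢head 2≤N e with o e
  ... | true  = nextV-irreflexive 2≤N e ∘ sym
  ... | false = nextV-irreflexive 2≤N e

  incident-self : ∀ e → Incident N o e e
  incident-self e with o e
  ... | true  = inj₁ refl
  ... | false = inj₂ refl

  incident-nextV : ∀ e → Incident N o (nextV N e) e
  incident-nextV e with o e
  ... | true  = inj₂ refl
  ... | false = inj₁ refl

  source-tail : ∀ {s} → IsSource N o s → tail N o s ≡ s
  source-tail {s} src = src s (incident-self s)

  sink-head : ∀ {t} → IsSink N o t → head N o t ≡ t
  sink-head {t} snk = snk t (incident-self t)

  source-incoming : 2 ≤ N → ∀ {s} → IsSource N o s → ∀ e → nextV N e ≡ s → o e ≡ false
  source-incoming 2≤N src e refl with o e | src e (incident-nextV e)
  ... | true  | e≡e⁺ = contradiction (sym e≡e⁺) (nextV-irreflexive 2≤N e)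
  ... | false | _    = refl

  sink-incoming : 2 ≤ N → ∀ {t} → IsSink N o t → ∀ e → nextV N e ≡ t → o e ≡ true
  sink-incoming 2≤N snk e refl with o e | snk e (incident-nextV e)
  ... | true  | _    = refl
  ... | false | e≡e⁺ = contradiction (sym e≡e⁺) (nextV-irreflexive 2≤N e)

m+[n+[o∸m]]≡n+o : ∀ m n {o} → m ≤ o → m + (n + (o ∸ m)) ≡ n + o
m+[n+[o∸m]]≡n+o m n {o} m≤o = begin
  m + (n + (o ∸ m))   ≡⟨ +-assoc m n (o ∸ m) ⟨
  m + n + (o ∸ m)     ≡⟨ cong (_+ (o ∸ m)) (+-comm m n) ⟩
  n + m + (o ∸ m)     ≡⟨ +-assoc n m (o ∸ m) ⟩
  n + (m + (o ∸ m))   ≡⟨ cong (n +_) (m+[n∸m]≡n m≤o) ⟩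
  n + o               ∎
  where open ≡-Reasoning

module CycleSpiral (m : ℕ) (o : Fin (suc (suc m)) → Bool) (x : Fin (suc (suc m))) where

  N : ℕ
  N = suc (suc m)

  2≤N : 2 ≤ N
  2≤N = s≤s (s≤s z≤n)

  at : ℕ → Fin N
  at zero    = x
  at (suc d) = nextV N (at d)

  -- the d in 1 … N with at d ≡ v
  distance : Fin N → ℕ
  distance v = suc ((toℕ v + (N ∸ suc (toℕ x))) % N)

  toℕ-at : ∀ d → toℕ (at d) ≡ (toℕ x + d) % N
  toℕ-at zero    = sym (trans (cong (_% N) (+-identityʳ (toℕ x))) (m<n⇒m%n≡m (toℕ<n x)))
  toℕ-at (suc d) = begin
    toℕ (nextV N (at d))      ≡⟨ toℕ-nextV (at d) ⟩
    suc (toℕ (at d)) % N      ≡⟨ cong (λ k → suc k % N) (toℕ-at d) ⟩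
    (1 + (toℕ x + d) % N) % N ≡⟨ [m+n%o]%o≡[m+n]%o 1 (toℕ x + d) N ⟩
    suc (toℕ x + d) % N       ≡⟨ cong (_% N) (+-suc (toℕ x) d) ⟨
    (toℕ x + suc d) % N       ∎
    where open ≡-Reasoning

  at-period : at N ≡ x
  at-period = toℕ-injective (begin
    toℕ (at N)      ≡⟨ toℕ-at N ⟩
    (toℕ x + N) % N ≡⟨ [m+n]%n≡m%n (toℕ x) N ⟩
    toℕ x % N       ≡⟨ m<n⇒m%n≡m (toℕ<n x) ⟩
    toℕ x           ∎)
    where open ≡-Reasoning

  at-distance : ∀ v → at (distance v) ≡ v
  at-distance v = toℕ-injective (begin
    toℕ (at (distance v))               ≡⟨ toℕ-at (distance v) ⟩
    (toℕ x + suc (r % N)) % N           ≡⟨ cong (_% N) (+-suc (toℕ x) (r % N)) ⟩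
    (suc (toℕ x) + r % N) % N           ≡⟨ [m+n%o]%o≡[m+n]%o (suc (toℕ x)) r N ⟩
    (suc (toℕ x) + (toℕ v + c)) % N     ≡⟨ cong (_% N) (m+[n+[o∸m]]≡n+o (suc (toℕ x)) (toℕ v) (toℕ<n x)) ⟩
    (toℕ v + N) % N                     ≡⟨ [m+n]%n≡m%n (toℕ v) N ⟩
    toℕ v % N                           ≡⟨ m<n⇒m%n≡m (toℕ<n v) ⟩
    toℕ v                               ∎)
    where
    open ≡-Reasoning
    c = N ∸ suc (toℕ x)
    r = toℕ v + c

  distance-at : ∀ d → suc d ≤ N → distance (at (suc d)) ≡ suc d
  distance-at d d<N = cong suc (begin
    (toℕ (at (suc d)) + c) % N     ≡⟨ cong (λ k → (k + c) % N) (toℕ-at (suc d)) ⟩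
    ((toℕ x + suc d) % N + c) % N ≡⟨ cong (_% N) (+-comm ((toℕ x + suc d) % N) c) ⟩
    (c + (toℕ x + suc d) % N) % N ≡⟨ [m+n%o]%o≡[m+n]%o c (toℕ x + suc d) N ⟩
    (c + (toℕ x + suc d)) % N     ≡⟨ cong (_% N) (+-comm c (toℕ x + suc d)) ⟩
    (toℕ x + suc d + c) % N       ≡⟨ cong (λ k → (k + c) % N) (+-suc (toℕ x) d) ⟩
    (suc (toℕ x) + d + c) % N     ≡⟨ cong (_% N) (+-assoc (suc (toℕ x)) d c) ⟩
    (suc (toℕ x) + (d + c)) % N   ≡⟨ cong (_% N) (m+[n+[o∸m]]≡n+o (suc (toℕ x)) d (toℕ<n x)) ⟩
    (d + N) % N                   ≡⟨ [m+n]%n≡m%n d N ⟩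
    d % N                         ≡⟨ m<n⇒m%n≡m d<N ⟩
    d                             ∎)
    where
    open ≡-Reasoning
    c = N ∸ suc (toℕ x)

  distance≤N : ∀ v → distance v ≤ N
  distance≤N v = m%n<n (toℕ v + (N ∸ suc (toℕ x))) N

  distance<N : ∀ {e} → e ≢ x → suc (distance e) ≤ N
  distance<N {e} e≢x = ≤∧≢⇒< (distance≤N e) λ d≡N →
    e≢x (trans (sym (at-distance e)) (trans (cong at d≡N) at-period))

  distance-x : distance x ≡ N
  distance-x = trans (cong distance (sym at-period)) (distance-at (suc m) ≤-refl)

  open Spiral N (λ d → o (at d))

  K : Fin N → ℕ
  K v = key (distance v)

  K-injective : Injective _≡_ _≡_ K
  K-injective {u} {v} eq = begin
    u                ≡⟨ at-distance u ⟨
    at (distance u)  ≡⟨ cong (at ∘ suc) (key-injective (distance≤N u) (distance≤N v) eq) ⟩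
    at (distance v)  ≡⟨ at-distance v ⟩
    v                ∎
    where open ≡-Reasoning

  K-at : ∀ d → suc d ≤ N → K (at (suc d)) ≡ key (suc d)
  K-at d d<N = cong key (distance-at d d<N)

  K-tail-at : ∀ d → suc (suc d) ≤ N → K (tail N o (at (suc d))) ≡ key (tailDist (suc d))
  K-tail-at d bound with o (at (suc d))
  ... | true  = K-at d (<⇒≤ bound)
  ... | false = K-at (suc d) bound

  K-head-at : ∀ d → suc (suc d) ≤ N → K (head N o (at (suc d))) ≡ key (headDist (suc d))
  K-head-at d bound with o (at (suc d))
  ... | true  = K-at (suc d) bound
  ... | false = K-at d (<⇒≤ bound)

  K-tail : ∀ {e} → e ≢ x → K (tail N o e) ≡ key (tailDist (distance e))
  K-tail {e} e≢x = begin
    K (tail N o e)                ≡⟨ cong (K ∘ tail N o) (at-distance e) ⟨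
    K (tail N o (at (distance e))) ≡⟨ K-tail-at _ (distance<N e≢x) ⟩
    key (tailDist (distance e))   ∎
    where open ≡-Reasoning

  K-head : ∀ {e} → e ≢ x → K (head N o e) ≡ key (headDist (distance e))
  K-head {e} e≢x = begin
    K (head N o e)                ≡⟨ cong (K ∘ head N o) (at-distance e) ⟨
    K (head N o (at (distance e))) ≡⟨ K-head-at _ (distance<N e≢x) ⟩
    key (headDist (distance e))   ∎
    where open ≡-Reasoning

  path-upward : ∀ {e} → e ≢ x → K (tail N o e) < K (head N o e)
  path-upward e≢x = subst₂ _<_ (sym (K-tail e≢x)) (sym (K-head e≢x)) (spiral-upward _ (distance<N e≢x))

  path-noncrossing : ∀ {e f} → e ≢ x → f ≢ x →
    ¬ Crossing (K (tail N o e)) (K (head N o e)) (K (tail N o f)) (K (head N o f))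
  path-noncrossing e≢x f≢x
    rewrite K-tail e≢x | K-head e≢x | K-tail f≢x | K-head f≢x =
    spiral-noncrossing _ _ (distance<N e≢x) (distance<N f≢x)

  page : Fin N → Fin 2
  page e with e ≟ x
  ... | yes _ = suc zero
  ... | no _  = zero

  spiral-embedding : K (tail N o x) < K (head N o x) → IsUpwardBookEmbedding N 2 o (rankFin K) page
  spiral-embedding x-upward = embedding-by-rank {o = o} {σ = page} K K-injective upward noncrossing
    where
    upward : ∀ e → K (tail N o e) < K (head N o e)
    upward e with e ≟ x
    ... | yes refl = x-upward
    ... | no e≢x   = path-upward e≢x

    noncrossing : ∀ e f → page e ≡ page f →
      ¬ Crossing (K (tail N o e)) (K (head N o e)) (K (tail N o f)) (K (head N o f))
    noncrossing e f same-page with e ≟ x | f ≟ x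
    ... | yes refl | yes refl = λ (t<t , _) → <-irrefl refl t<t
    ... | no e≢x   | no f≢x   = path-noncrossing e≢x f≢x
    ... | yes _    | no _     = contradiction same-page λ ()
    ... | no _     | yes _    = contradiction same-page λ ()

  K-x : K x ≡ place (o (at (suc m))) N
  K-x = cong key distance-x

  extreme-upward : K (tail N o x) ≤ K (head N o x) → K (tail N o x) < K (head N o x)
  extreme-upward le = ≤∧≢⇒< le λ eq → tail≢head {o = o} 2≤N x (K-injective eq)

  source-first : IsSource N o x →
    Σ (Fin N → Fin N) λ π → Σ (Fin N → Fin 2) λ σ → IsUpwardBookEmbedding N 2 o π σ × pos N π x ≡ 0
  source-first src = rankFin K , page , spiral-embedding x-upward , x-first
    where
    K-x≡0 : K x ≡ 0
    K-x≡0 = begin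
      K x                      ≡⟨ K-x ⟩
      place (o (at (suc m))) N ≡⟨ cong (λ b → place b N) (source-incoming {o = o} 2≤N src (at (suc m)) at-period) ⟩
      N ∸ N                    ≡⟨ n∸n≡0 N ⟩
      0                        ∎
      where open ≡-Reasoning

    x-upward : K (tail N o x) < K (head N o x)
    x-upward = extreme-upward (subst (_≤ K (head N o x)) (sym (trans (cong K (source-tail {o = o} src)) K-x≡0)) z≤n)

    x-first : pos N (rankFin K) x ≡ 0
    x-first = trans (toℕ-rankFin K x) (rank-minimum K {x} λ u → subst (_≤ K u) (sym K-x≡0) z≤n)

  sink-last : IsSink N o x →
    Σ (Fin N → Fin N) λ π → Σ (Fin N → Fin 2) λ σ → IsUpwardBookEmbedding N 2 o π σ × suc (pos N π x) ≡ N
  sink-last snk = rankFin K , page , spiral-embedding x-upward , x-last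
    where
    K≤N+N : ∀ v → K v ≤ N + N
    K≤N+N v = ≤-trans (key≤ (distance v)) (+-monoʳ-≤ N (distance≤N v))

    K-x≡N+N : K x ≡ N + N
    K-x≡N+N = trans K-x (cong (λ b → place b N) (sink-incoming {o = o} 2≤N snk (at (suc m)) at-period))

    x-upward : K (tail N o x) < K (head N o x)
    x-upward = extreme-upward (subst (K (tail N o x) ≤_) (sym (trans (cong K (sink-head {o = o} snk)) K-x≡N+N))
                                     (K≤N+N (tail N o x)))

    x-last : suc (pos N (rankFin K) x) ≡ N
    x-last = trans (cong suc (toℕ-rankFin K x))
                   (rank-maximum K K-injective {x} λ u → subst (K u ≤_) (sym K-x≡N+N) (K≤N+N u))

lemma15 : (n : ℕ) .{{_ : NonZero n}} → 3 ≤ n → (o : Fin n → Bool) → IsDAG n o →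
          (∀ s → IsSource n o s →
            Σ (Fin n → Fin n) λ π → Σ (Fin n → Fin 2) λ σ →
              IsUpwardBookEmbedding n 2 o π σ × pos n π s ≡ 0)
          × (∀ t → IsSink n o t →
            Σ (Fin n → Fin n) λ π → Σ (Fin n → Fin 2) λ σ →
              IsUpwardBookEmbedding n 2 o π σ × suc (pos n π t) ≡ n)
lemma15 (suc (suc (suc k))) (s≤s (s≤s (s≤s _))) o _ =
    (λ s → CycleSpiral.source-first (suc k) o s)
  , (λ t → CycleSpiral.sink-last (suc k) o t)
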